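{- Every loopless digraph that contains neither $\mathbb{K}_3$ nor $\vec{\mathbb{P}}_4$ as a subgraph admits a homomorphism to $\vec{\mathbb{C}}_3^{++}$.
   Context: $\mathbb{K}_3$ is the digraph on $\{1,2,3\}$ with all edges $(i,j)$, $i\neq j$. $\vec{\mathbb{P}}_4$ is the directed path with vertices $1,2,3,4$ and edges $(1,2),(2,3),(3,4)$. $\vec{\mathbb{C}}_3^{++}$ is the digraph obtained from the directed 3-cycle by adding two edges, i.e., $\mathbb{K}_3$ minus one edge: vertices $a,b,c$ with edges $(a,b),(b,c),(c,a),(a,c),(c,b)$. "Contains as a subgraph" means not necessarily induced. A homomorphism is an edge-preserving vertex map. -}

module Defs where

open import Data.Nat using (ℕ)
open import Data.Fin using (Fin; zero; suc)
open import Data.Bool using (Bool; true; false; T)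
open import Data.Product using (Σ; _×_)
open import Relation.Binary.PropositionalEquality using (_≡_; _≢_)
open import Relation.Nullary using (¬_)
open import Function.Definitions using (Injective)

record Digraph : Set where
  field
    size : ℕ
    adj  : Fin size → Fin size → Bool

open Digraph public

Vertex : Digraph → Set
Vertex G = Fin (size G)

Edge : (G : Digraph) → Vertex G → Vertex G → Set
Edge G u v = T (adj G u v)

Loopless : Digraph → Set
Loopless G = (v : Vertex G) → ¬ Edge G v v

Hom : Digraph → Digraph → Set
Hom G H = Σ (Vertex G → Vertex H) λ f →
  ∀ u v → Edge G u v → Edge H (f u) (f v)

-- H is a (not necessarily induced) subgraph of G: injective homomorphism H → G.
ContainsSubgraph : Digraph → Digraph → Set
ContainsSubgraph G H = Σ (Vertex H → Vertex G) λ f →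
  Injective _≡_ _≡_ f × (∀ u v → Edge H u v → Edge G (f u) (f v))

private
  neq : Fin 3 → Fin 3 → Bool
  neq zero zero = false
  neq (suc zero) (suc zero) = false
  neq (suc (suc zero)) (suc (suc zero)) = false
  neq _ _ = true

K3 : Digraph
K3 = record { size = 3 ; adj = neq }

private
  p4 : Fin 4 → Fin 4 → Bool
  p4 zero (suc zero) = true
  p4 (suc zero) (suc (suc zero)) = true
  p4 (suc (suc zero)) (suc (suc (suc zero))) = true
  p4 _ _ = false

P4 : Digraph
P4 = record { size = 4 ; adj = p4 }

private
  -- a = 0, b = 1, c = 2; edges (a,b),(b,c),(c,a),(a,c),(c,b); missing (b,a).
  c3pp : Fin 3 → Fin 3 → Bool
  c3pp zero (suc zero) = true
  c3pp (suc zero) (suc (suc zero)) = true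
  c3pp (suc (suc zero)) zero = true
  c3pp zero (suc (suc zero)) = true
  c3pp (suc (suc zero)) (suc zero) = true
  c3pp _ _ = false

C3++ : Digraph
C3++ = record { size = 3 ; adj = c3pp }

-- Call a vertex middle if it has both an in- and an out-neighbour.  Order the
-- vertices by whether they have two distinct neighbours, then by their number of
-- digon partners (capped at 2), then by index, and call a middle vertex a peak if
-- no adjacent middle vertex outranks it.  Peaks are pairwise non-adjacent, and
-- every directed 2-walk x → v → y contains a peak.  If v lies on a directed
-- triangle, excluding P4 makes the triangle a whole component; its maximum is a
-- peak, which avoids the walk only if x = y, and then, since K3 is excluded, one
-- of the two ends of the digon v ⟷ x outranks it.  Otherwise every middle
-- neighbour of v forms a digon with it, and excluding P4 leaves a vertex that
-- outranks v, x or y only two options: it is outranked back, or it is a pendant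
-- vertex, which cannot outrank its branching neighbour.  Colouring the peaks c,
-- the other vertices with an in-neighbour outside the peaks b, and the rest a
-- then never uses b → a, the only non-loop edge missing from C3++.
module Submission where

open import Defs
open import Data.Nat using (ℕ; _+_; _<_; _≤_; z≤n; s≤s)
open import Data.Nat.Properties using (<-isStrictTotalOrder; ≤-refl; +-mono-≤-<; +-mono-<-≤)
open import Data.Fin using (Fin; zero; suc; toℕ)
open import Data.Fin.Properties using (any?; toℕ-injective; _≟_)
open import Data.Bool.Properties using (T?)
open import Data.Empty using (⊥; ⊥-elim)
open import Data.Unit using (tt)
open import Data.Product using (∃; ∃₂; _×_; _,_; proj₁; proj₂)
open import Data.Product.Relation.Binary.Lex.Strict using (×-Lex; ×-isStrictTotalOrder)
open import Data.Product.Relation.Binary.Pointwise.NonDependent using (Pointwise)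
open import Level using (0ℓ)
open import Data.Sum using (_⊎_; inj₁; inj₂)
open import Data.List using (List; []; _∷_)
open import Data.List.Membership.Propositional using (_∈_)
open import Data.List.Relation.Unary.Any using (here; there)
open import Data.Vec using (_∷_; []; lookup)
open import Data.Vec.Relation.Unary.All using (_∷_; [])
open import Data.Vec.Relation.Unary.AllPairs using (_∷_; [])
open import Data.Vec.Relation.Unary.Unique.Propositional using (Unique)
open import Data.Vec.Relation.Unary.Unique.Propositional.Properties using (lookup-injective)
open import Relation.Binary.Core using (Rel)
open import Relation.Binary.Definitions using (tri<; tri≈; tri>)
open import Relation.Binary.Structures using (IsStrictTotalOrder)
open import Relation.Binary.PropositionalEquality using (_≡_; _≢_; refl; subst; ≢-sym)
open import Relation.Nullary using (¬_; Dec; yes; no)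
open import Relation.Nullary.Decidable using (_×-dec_; _⊎-dec_; ¬?; decidable-stable)

count : {P : Set} → Dec P → ℕ
count (yes _) = 1
count (no _) = 0

count-mono : {P Q : Set} (p : Dec P) (q : Dec Q) → (P → Q) → count p ≤ count q
count-mono (yes _) (yes _) _ = ≤-refl
count-mono (yes p) (no ¬q) P⇒Q = ⊥-elim (¬q (P⇒Q p))
count-mono (no _) _ _ = z≤n

count-< : {P Q : Set} (p : Dec P) (q : Dec Q) → ¬ P → Q → count p < count q
count-< (no _) (yes _) _ _ = s≤s z≤n
count-< (yes p) _ ¬p _ = ⊥-elim (¬p p)
count-< (no _) (no ¬q) _ q = ⊥-elim (¬q q)

count-≡ : {P Q : Set} (p : Dec P) (q : Dec Q) → P → Q → count p ≡ count q
count-≡ (yes _) (yes _) _ _ = refl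
count-≡ (no ¬p) _ p _ = ⊥-elim (¬p p)
count-≡ (yes _) (no ¬q) _ q = ⊥-elim (¬q q)

module Notions (G : Digraph) where
  infix 4 _⟶_ _⟶?_ _~_ _~?_ _⟷_ _⟷?_

  V : Set
  V = Vertex G

  _⟶_ : V → V → Set
  _⟶_ = Edge G

  _⟶?_ : ∀ u v → Dec (u ⟶ v)
  u ⟶? v = T? (adj G u v)

  _~_ : V → V → Set
  u ~ v = u ⟶ v ⊎ v ⟶ u

  _~?_ : ∀ u v → Dec (u ~ v)
  u ~? v = (u ⟶? v) ⊎-dec (v ⟶? u)

  ~-sym : ∀ {u v} → u ~ v → v ~ u
  ~-sym (inj₁ uv) = inj₂ uv
  ~-sym (inj₂ vu) = inj₁ vu

  _⟷_ : V → V → Set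
  u ⟷ v = u ⟶ v × v ⟶ u

  _⟷?_ : ∀ u v → Dec (u ⟷ v)
  u ⟷? v = (u ⟶? v) ×-dec (v ⟶? u)

  ⟷-sym : ∀ {u v} → u ⟷ v → v ⟷ u
  ⟷-sym (uv , vu) = vu , uv

  Middle : V → Set
  Middle v = (∃ λ p → p ⟶ v) × (∃ λ q → v ⟶ q)

  Middle? : ∀ v → Dec (Middle v)
  Middle? v = any? (λ p → p ⟶? v) ×-dec any? (λ q → v ⟶? q)

  digon-middle : ∀ {u v} → u ⟷ v → Middle u
  digon-middle {u} {v} (uv , vu) = (v , vu) , (v , uv)

  TwoDistinct : (V → V → Set) → V → Set
  TwoDistinct R v = ∃₂ λ p q → p ≢ q × R v p × R v q

  TwoDistinct? : {R : V → V → Set} → (∀ u v → Dec (R u v)) → ∀ v → Dec (TwoDistinct R v)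
  TwoDistinct? R? v = any? λ p → any? λ q → ¬? (p ≟ q) ×-dec R? v p ×-dec R? v q

  unique-partner : ∀ {R : V → V → Set} {u v} → (∀ {q} → R v q → q ≡ u) → ¬ TwoDistinct R v
  unique-partner only (p , q , p≢q , vp , vq) with refl ← only vp | refl ← only vq = p≢q refl

  Branching : V → Set
  Branching = TwoDistinct _~_

  Branching? : ∀ v → Dec (Branching v)
  Branching? = TwoDistinct? _~?_

  OnDigon : V → Set
  OnDigon v = ∃ (v ⟷_)

  OnDigon? : ∀ v → Dec (OnDigon v)
  OnDigon? v = any? (v ⟷?_)

  TwoDigons : V → Set
  TwoDigons = TwoDistinct _⟷_

  TwoDigons? : ∀ v → Dec (TwoDigons v)
  TwoDigons? = TwoDistinct? _⟷?_

  two-digons⇒on-digon : ∀ {v} → TwoDigons v → OnDigon v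
  two-digons⇒on-digon (p , _ , _ , vp , _) = p , vp

  OnTriangle : V → Set
  OnTriangle v = ∃₂ λ p q → v ⟶ p × p ⟶ q × q ⟶ v

  OnTriangle? : ∀ v → Dec (OnTriangle v)
  OnTriangle? v = any? λ p → any? λ q → (v ⟶? p) ×-dec (p ⟶? q) ×-dec (q ⟶? v)

module _ (G : Digraph) where
  open Notions G

  path⇒P4 : ∀ {a b c d} → Unique (a ∷ b ∷ c ∷ d ∷ []) →
            a ⟶ b → b ⟶ c → c ⟶ d → ContainsSubgraph G P4
  path⇒P4 {a} {b} {c} {d} distinct ab bc cd =
    f , (λ {i} {j} → lookup-injective distinct i j) , preserves
    where
    f : Fin 4 → V
    f = lookup (a ∷ b ∷ c ∷ d ∷ [])
    preserves : ∀ i j → Edge P4 i j → f i ⟶ f j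
    preserves zero (suc zero) _ = ab
    preserves (suc zero) (suc (suc zero)) _ = bc
    preserves (suc (suc zero)) (suc (suc (suc zero))) _ = cd
    preserves zero zero ()
    preserves zero (suc (suc _)) ()
    preserves (suc zero) zero ()
    preserves (suc zero) (suc zero) ()
    preserves (suc zero) (suc (suc (suc _))) ()
    preserves (suc (suc zero)) zero ()
    preserves (suc (suc zero)) (suc zero) ()
    preserves (suc (suc zero)) (suc (suc zero)) ()
    preserves (suc (suc (suc _))) _ ()

  digon-triangle⇒K3 : ∀ {a b c} → Unique (a ∷ b ∷ c ∷ []) →
                      a ⟷ b → a ⟷ c → b ⟷ c → ContainsSubgraph G K3
  digon-triangle⇒K3 {a} {b} {c} distinct (ab , ba) (ac , ca) (bc , cb) =
    f , (λ {i} {j} → lookup-injective distinct i j) , preserves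
    where
    f : Fin 3 → V
    f = lookup (a ∷ b ∷ c ∷ [])
    preserves : ∀ i j → Edge K3 i j → f i ⟶ f j
    preserves zero (suc zero) _ = ab
    preserves zero (suc (suc zero)) _ = ac
    preserves (suc zero) zero _ = ba
    preserves (suc zero) (suc (suc zero)) _ = bc
    preserves (suc (suc zero)) zero _ = ca
    preserves (suc (suc zero)) (suc zero) _ = cb
    preserves zero zero ()
    preserves (suc zero) (suc zero) ()
    preserves (suc (suc zero)) (suc (suc zero)) ()

  independent-2-walk-transversal⇒Hom-C3++ :
    (S : V → Set) → (∀ v → Dec (S v)) →
    (∀ {u v} → S u → S v → ¬ u ⟶ v) →
    (∀ {x v y} → x ⟶ v → v ⟶ y → ¬ S x → ¬ S v → ¬ S y → ⊥) →
    Hom G C3++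
  independent-2-walk-transversal⇒Hom-C3++ S S? independent transversal =
    (λ v → colour (S? v) (FedOutside? v)) ,
    (λ u v uv → colour-edge uv (S? u) (FedOutside? u) (S? v) (FedOutside? v))
    where
    FedOutside : V → Set
    FedOutside v = ∃ λ u → ¬ S u × u ⟶ v

    FedOutside? : ∀ v → Dec (FedOutside v)
    FedOutside? v = any? λ u → ¬? (S? u) ×-dec (u ⟶? v)

    colour : ∀ {v} → Dec (S v) → Dec (FedOutside v) → Fin 3
    colour (yes _) _ = suc (suc zero)
    colour (no _) (no _) = zero
    colour (no _) (yes _) = suc zero

    colour-edge : ∀ {u v} → u ⟶ v →
      (su : Dec (S u)) (fu : Dec (FedOutside u)) (sv : Dec (S v)) (fv : Dec (FedOutside v)) →
      Edge C3++ (colour su fu) (colour sv fv)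
    colour-edge uv (yes su) _ (yes sv) _ = ⊥-elim (independent su sv uv)
    colour-edge uv (yes _) _ (no _) (no _) = tt
    colour-edge uv (yes _) _ (no _) (yes _) = tt
    colour-edge uv (no _) (no _) (yes _) _ = tt
    colour-edge uv (no _) (yes _) (yes _) _ = tt
    colour-edge uv (no _) (no _) (no _) (yes _) = tt
    colour-edge {u} uv (no ¬su) _ (no _) (no ¬fv) = ⊥-elim (¬fv (u , ¬su , uv))
    colour-edge uv (no ¬su) (yes (x , ¬sx , xu)) (no ¬sv) (yes _) = transversal xu uv ¬sx ¬su ¬sv

module Peaks (G : Digraph) (loopless : Loopless G)
             (K3-free : ¬ ContainsSubgraph G K3) (P4-free : ¬ ContainsSubgraph G P4) where
  open Notions G

  ⟶⇒≢ : ∀ {u v} → u ⟶ v → u ≢ v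
  ⟶⇒≢ {u} uu refl = loopless u uu

  ~⇒≢ : ∀ {u v} → u ~ v → u ≢ v
  ~⇒≢ (inj₁ uv) = ⟶⇒≢ uv
  ~⇒≢ (inj₂ vu) = ≢-sym (⟶⇒≢ vu)

  no-P4-path : ∀ {a b c d} → a ≢ c → a ≢ d → b ≢ d → a ⟶ b → b ⟶ c → c ⟶ d → ⊥
  no-P4-path a≢c a≢d b≢d ab bc cd = P4-free (path⇒P4 G
    ((⟶⇒≢ ab ∷ a≢c ∷ a≢d ∷ []) ∷ (⟶⇒≢ bc ∷ b≢d ∷ []) ∷ (⟶⇒≢ cd ∷ []) ∷ [] ∷ [])
    ab bc cd)

  no-digon-triangle : ∀ {a b c} → a ⟷ b → a ⟷ c → b ⟷ c → ⊥
  no-digon-triangle ab ac bc = K3-free (digon-triangle⇒K3 G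
    ((⟶⇒≢ (proj₁ ab) ∷ ⟶⇒≢ (proj₁ ac) ∷ []) ∷ (⟶⇒≢ (proj₁ bc) ∷ []) ∷ [] ∷ [])
    ab ac bc)

  triangle-neighbour : ∀ {v p q z} → v ⟶ p → p ⟶ q → q ⟶ v → v ~ z → z ≡ p ⊎ z ≡ q
  triangle-neighbour {v} {p} {q} {z} vp pq qv v~z with z ≟ p | z ≟ q
  ... | yes z≡p | _ = inj₁ z≡p
  ... | no _ | yes z≡q = inj₂ z≡q
  ... | no z≢p | no z≢q = ⊥-elim (leaves v~z)
    where
    leaves : v ~ z → ⊥
    leaves (inj₁ vz) = no-P4-path (≢-sym (⟶⇒≢ vp)) (≢-sym z≢p) (≢-sym z≢q) pq qv vz
    leaves (inj₂ zv) = no-P4-path z≢p z≢q (≢-sym (⟶⇒≢ qv)) zv vp pq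

  off-triangle-spreads : ∀ {v x} → ¬ OnTriangle v → v ~ x → ¬ OnTriangle x
  off-triangle-spreads ¬tri v~x (p , q , xp , pq , qx) with triangle-neighbour xp pq qx (~-sym v~x)
  ... | inj₁ refl = ¬tri (q , _ , pq , qx , xp)
  ... | inj₂ refl = ¬tri (_ , p , qx , xp , pq)

  digonScore : V → ℕ
  digonScore v = count (OnDigon? v) + count (TwoDigons? v)

  -- Opaque, so that `with` over types mentioning _≻_ does not unfold the key.
  opaque
    key : V → ℕ × ℕ × ℕ
    key v = count (Branching? v) , digonScore v , toℕ v

    _<ₖ_ : Rel (ℕ × ℕ × ℕ) 0ℓ
    _<ₖ_ = ×-Lex _≡_ _<_ (×-Lex _≡_ _<_ _<_)

    <ₖ-isStrictTotalOrder : IsStrictTotalOrder (Pointwise _≡_ (Pointwise _≡_ _≡_)) _<ₖ_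
    <ₖ-isStrictTotalOrder = ×-isStrictTotalOrder <-isStrictTotalOrder
      (×-isStrictTotalOrder <-isStrictTotalOrder <-isStrictTotalOrder)

    open IsStrictTotalOrder <ₖ-isStrictTotalOrder
      using (compare) renaming (asym to <ₖ-asym; trans to <ₖ-trans; _<?_ to _<ₖ?_)

    infix 4 _≻_ _≻?_

    _≻_ : V → V → Set
    w ≻ v = key v <ₖ key w

    _≻?_ : ∀ w v → Dec (w ≻ v)
    w ≻? v = key v <ₖ? key w

    ≻-asym : ∀ {u v} → u ≻ v → ¬ v ≻ u
    ≻-asym = <ₖ-asym

    ≻-irrefl : ∀ {v} → ¬ v ≻ v
    ≻-irrefl v≻v = ≻-asym v≻v v≻v

    ≻-trans : ∀ {u v w} → u ≻ v → v ≻ w → u ≻ w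
    ≻-trans u≻v v≻w = <ₖ-trans v≻w u≻v

    ≻-total : ∀ {u v} → u ≢ v → u ≻ v ⊎ v ≻ u
    ≻-total {u} {v} u≢v with compare (key u) (key v)
    ... | tri< u<v _ _ = inj₂ u<v
    ... | tri≈ _ (_ , _ , same-index) _ = ⊥-elim (u≢v (toℕ-injective same-index))
    ... | tri> _ _ v<u = inj₁ v<u

    branching-≻ : ∀ {v w} → Branching v → ¬ Branching w → v ≻ w
    branching-≻ {v} {w} bv ¬bw = inj₁ (count-< (Branching? w) (Branching? v) ¬bw bv)

    digonScore-≻ : ∀ {v w} → Branching v → Branching w → digonScore w < digonScore v → v ≻ w
    digonScore-≻ {v} {w} bv bw fewer =
      inj₂ (count-≡ (Branching? w) (Branching? v) bw bv , inj₁ fewer)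

    two-digons-≻ : ∀ {v w} → Branching v → Branching w → TwoDigons v → ¬ TwoDigons w → v ≻ w
    two-digons-≻ {v} {w} bv bw two ¬two = digonScore-≻ bv bw (+-mono-≤-<
      (count-mono (OnDigon? w) (OnDigon? v) (λ _ → two-digons⇒on-digon two))
      (count-< (TwoDigons? w) (TwoDigons? v) ¬two two))

    digon-≻ : ∀ {v w} → Branching v → Branching w → OnDigon v → ¬ OnDigon w → v ≻ w
    digon-≻ {v} {w} bv bw on ¬on = digonScore-≻ bv bw (+-mono-<-≤
      (count-< (OnDigon? w) (OnDigon? v) ¬on on)
      (count-mono (TwoDigons? w) (TwoDigons? v) (λ two → ⊥-elim (¬on (two-digons⇒on-digon two)))))

  leaf-⊁-branching : ∀ {z u} → (∀ {q} → z ~ q → q ≡ u) → Branching u → ¬ z ≻ u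
  leaf-⊁-branching only-u bu = ≻-asym (branching-≻ bu (unique-partner {R = _~_} only-u))

  Beaten : V → Set
  Beaten v = ∃ λ w → Middle w × v ~ w × w ≻ v

  Peak : V → Set
  Peak v = Middle v × ¬ Beaten v

  Beaten? : ∀ v → Dec (Beaten v)
  Beaten? v = any? λ w → Middle? w ×-dec (v ~? w) ×-dec (w ≻? v)

  Peak? : ∀ v → Dec (Peak v)
  Peak? v = Middle? v ×-dec ¬? (Beaten? v)

  beaten : ∀ {v} → Middle v → ¬ Peak v → Beaten v
  beaten {v} mv ¬peak = decidable-stable (Beaten? v) λ unbeaten → ¬peak (mv , unbeaten)

  peaks-independent : ∀ {u v} → Peak u → Peak v → ¬ u ⟶ v
  peaks-independent {u} {v} (mu , ¬beaten-u) (mv , ¬beaten-v) uv with ≻-total (⟶⇒≢ uv)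
  ... | inj₁ u≻v = ¬beaten-v (u , mu , inj₂ uv , u≻v)
  ... | inj₂ v≻u = ¬beaten-u (v , mv , inj₁ uv , v≻u)

  Closed : List V → Set
  Closed S = ∀ {t z} → t ~ z → t ∈ S → z ∈ S

  maximum : ∀ v vs → ∃ λ m → m ∈ v ∷ vs × (∀ {z} → z ∈ v ∷ vs → ¬ z ≻ m)
  maximum v [] = v , here refl , λ { (here refl) → ≻-irrefl }
  maximum v (u ∷ us) with maximum u us
  ... | m , m∈ , m-max with v ≻? m
  ...   | no v⊁m = m , there m∈ , λ { (here refl) → v⊁m ; (there z∈) → m-max z∈ }
  ...   | yes v≻m = v , here refl , λ
          { (here refl) → ≻-irrefl ; (there z∈) z≻v → m-max z∈ (≻-trans z≻v v≻m) }

  maximum-of-closed-is-peak : ∀ {S m} → Closed S → m ∈ S → (∀ {z} → z ∈ S → ¬ z ≻ m) →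
                              Middle m → Peak m
  maximum-of-closed-is-peak closed m∈ m-max mm =
    mm , λ (w , _ , m~w , w≻m) → m-max (closed m~w m∈) w≻m

  triangle-closed : ∀ {v p q} → v ⟶ p → p ⟶ q → q ⟶ v → Closed (v ∷ p ∷ q ∷ [])
  triangle-closed vp pq qv t~z (here refl) with triangle-neighbour vp pq qv t~z
  ... | inj₁ z≡p = there (here z≡p)
  ... | inj₂ z≡q = there (there (here z≡q))
  triangle-closed vp pq qv t~z (there (here refl)) with triangle-neighbour pq qv vp t~z
  ... | inj₁ z≡q = there (there (here z≡q))
  ... | inj₂ z≡v = here z≡v
  triangle-closed vp pq qv t~z (there (there (here refl))) with triangle-neighbour qv vp pq t~z
  ... | inj₁ z≡v = here z≡v
  ... | inj₂ z≡p = there (here z≡p)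

  triangle-has-peak : ∀ {v p q} → v ⟶ p → p ⟶ q → q ⟶ v → ∃ λ m → Peak m × m ∈ v ∷ p ∷ q ∷ []
  triangle-has-peak {v} {p} {q} vp pq qv =
    let m , m∈ , m-max = maximum v (p ∷ q ∷ []) in
    m , maximum-of-closed-is-peak (triangle-closed vp pq qv) m∈ m-max (middle m∈) , m∈
    where
    middle : ∀ {m} → m ∈ v ∷ p ∷ q ∷ [] → Middle m
    middle (here refl) = (q , qv) , (p , vp)
    middle (there (here refl)) = (v , vp) , (q , pq)
    middle (there (there (here refl))) = (p , pq) , (v , qv)

  lone-digon-≻ : ∀ {v x t} → v ⟷ x → t ⟷ v → ¬ t ⟷ x → t ~ x →
                 (∀ {z} → t ~ z → z ≡ v ⊎ z ≡ x) → v ≻ t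
  lone-digon-≻ {v} {x} {t} vx tv ¬tx t~x only-v-x =
    two-digons-≻ (x , t , ~⇒≢ (~-sym t~x) , inj₁ (proj₁ vx) , inj₂ (proj₁ tv))
                 (v , x , ~⇒≢ (inj₁ (proj₁ vx)) , inj₁ (proj₁ tv) , t~x)
                 (x , t , ~⇒≢ (~-sym t~x) , vx , ⟷-sym tv)
                 (unique-partner {R = _⟷_} only-v)
    where
    only-v : ∀ {p} → t ⟷ p → p ≡ v
    only-v tp with only-v-x (inj₁ (proj₁ tp))
    ... | inj₁ p≡v = p≡v
    ... | inj₂ refl = ⊥-elim (¬tx tp)

  digon-≻-common-neighbour : ∀ {v x t} → v ⟷ x → t ~ v → t ~ x →
                             (∀ {z} → t ~ z → z ≡ v ⊎ z ≡ x) → v ≻ t ⊎ x ≻ t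
  digon-≻-common-neighbour {v} {x} {t} vx t~v t~x only-v-x with t ⟷? v | t ⟷? x
  ... | yes tv | yes tx = ⊥-elim (no-digon-triangle vx (⟷-sym tv) (⟷-sym tx))
  ... | yes tv | no ¬tx = inj₁ (lone-digon-≻ vx tv ¬tx t~x only-v-x)
  ... | no ¬tv | yes tx = inj₂ (lone-digon-≻ (⟷-sym vx) tx ¬tv t~v only-x-v)
    where
    only-x-v : ∀ {z} → t ~ z → z ≡ x ⊎ z ≡ v
    only-x-v t~z with only-v-x t~z
    ... | inj₁ z≡v = inj₂ z≡v
    ... | inj₂ z≡x = inj₁ z≡x
  ... | no ¬tv | no ¬tx = inj₁ (digon-≻ (x , t , ~⇒≢ (~-sym t~x) , inj₁ (proj₁ vx) , ~-sym t~v)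
                                        (v , x , ~⇒≢ (inj₁ (proj₁ vx)) , t~v , t~x)
                                        (x , vx) no-digon)
    where
    no-digon : ¬ OnDigon t
    no-digon (p , tp) with only-v-x (inj₁ (proj₁ tp))
    ... | inj₁ refl = ¬tv tp
    ... | inj₂ refl = ¬tx tp

  no-peak-beside-digon : ∀ {v x t} → v ⟷ x → t ~ v → t ~ x →
                         (∀ {z} → t ~ z → z ≡ v ⊎ z ≡ x) → ¬ Peak t
  no-peak-beside-digon vx t~v t~x only-v-x (_ , unbeaten)
    with digon-≻-common-neighbour vx t~v t~x only-v-x
  ... | inj₁ v≻t = unbeaten (_ , digon-middle vx , t~v , v≻t)
  ... | inj₂ x≻t = unbeaten (_ , digon-middle (⟷-sym vx) , t~x , x≻t)

  no-peakless-2-walk-on-triangle : ∀ {x v y p q} → v ⟶ p → p ⟶ q → q ⟶ v → x ⟶ v → v ⟶ y →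
                                   ¬ Peak x → ¬ Peak v → ¬ Peak y → ⊥
  no-peakless-2-walk-on-triangle vp pq qv xv vy ¬px ¬pv ¬py
    with triangle-has-peak vp pq qv
       | triangle-neighbour vp pq qv (inj₂ xv) | triangle-neighbour vp pq qv (inj₁ vy)
  ... | _ , peak , here refl | _ | _ = ¬pv peak
  ... | _ , peak , there (here refl) | inj₁ refl | _ = ¬px peak
  ... | _ , peak , there (here refl) | _ | inj₁ refl = ¬py peak
  ... | _ , peak , there (here refl) | inj₂ refl | inj₂ refl =
        no-peak-beside-digon (xv , vy) (inj₁ pq) (inj₂ vp) (triangle-neighbour pq qv vp) peak
  ... | _ , peak , there (there (here refl)) | inj₂ refl | _ = ¬px peak
  ... | _ , peak , there (there (here refl)) | _ | inj₂ refl = ¬py peak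
  ... | _ , peak , there (there (here refl)) | inj₁ refl | inj₁ refl =
        no-peak-beside-digon (vy , xv) (inj₁ qv) (inj₂ pq) (triangle-neighbour qv vp pq) peak
  ... | _ , _ , there (there (there ())) | _ | _

  middle-neighbours-form-digon : ∀ {v z} → ¬ OnTriangle v → Middle v → Middle z → v ~ z → v ⟷ z
  middle-neighbours-form-digon {v} {z} ¬tri ((a , av) , _) (_ , (b , zb)) (inj₁ vz) = vz , zv
    where
    zv : z ⟶ v
    zv with a ≟ z | b ≟ v | a ≟ b
    ... | yes refl | _ | _ = av
    ... | no _ | yes refl | _ = zb
    ... | no _ | no _ | yes refl = ⊥-elim (¬tri (z , a , vz , zb , av))
    ... | no a≢z | no b≢v | no a≢b = ⊥-elim (no-P4-path a≢z a≢b (≢-sym b≢v) av vz zb)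
  middle-neighbours-form-digon {v} {z} ¬tri (_ , (b , vb)) ((a , az) , _) (inj₂ zv) = vz , zv
    where
    vz : v ⟶ z
    vz with a ≟ v | b ≟ z | a ≟ b
    ... | yes refl | _ | _ = az
    ... | no _ | yes refl | _ = vb
    ... | no _ | no _ | yes refl = ⊥-elim (¬tri (a , z , vb , az , zv))
    ... | no a≢v | no b≢z | no a≢b = ⊥-elim (no-P4-path a≢v a≢b (≢-sym b≢z) az zv vb)

  digon-beater : ∀ {v} → ¬ OnTriangle v → Middle v → ¬ Peak v → ∃ λ w → v ⟷ w × w ≻ v
  digon-beater ¬tri mv ¬pv =
    let w , mw , v~w , w≻v = beaten mv ¬pv in
    w , middle-neighbours-form-digon ¬tri mv mw v~w , w≻v

  2-path-start-in-neighbour : ∀ {x v y z} → ¬ OnTriangle v → x ⟶ v → v ⟶ y → x ≢ y →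
                              z ⟶ x → z ≡ v
  2-path-start-in-neighbour {x} {v} {y} {z} ¬tri xv vy x≢y zx with z ≟ v | z ≟ y
  ... | yes z≡v | _ = z≡v
  ... | no _ | yes refl = ⊥-elim (¬tri (z , x , vy , zx , xv))
  ... | no z≢v | no z≢y = ⊥-elim (no-P4-path z≢v z≢y x≢y zx xv vy)

  2-path-end-out-neighbour : ∀ {x v y z} → ¬ OnTriangle v → x ⟶ v → v ⟶ y → x ≢ y →
                             y ⟶ z → z ≡ v
  2-path-end-out-neighbour {x} {v} {y} {z} ¬tri xv vy x≢y yz with z ≟ v | z ≟ x
  ... | yes z≡v | _ = z≡v
  ... | no _ | yes refl = ⊥-elim (¬tri (y , z , vy , yz , xv))
  ... | no z≢v | no z≢x = ⊥-elim (no-P4-path x≢y (≢-sym z≢x) (≢-sym z≢v) xv vy yz)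

  pendant-at-2-path : ∀ {x v y w q} → x ⟶ v → v ⟶ y → x ≢ y → v ⟷ w → w ≢ x → w ≢ y →
                      w ~ q → q ≡ v
  pendant-at-2-path {x} {v} {y} {w} {q} xv vy x≢y (vw , wv) w≢x w≢y w~q with q ≟ v
  ... | yes q≡v = q≡v
  ... | no q≢v = ⊥-elim (leaves w~q)
    where
    leaves : w ~ q → ⊥
    leaves (inj₁ wq) with q ≟ x
    ... | yes refl = no-P4-path (⟶⇒≢ wv) w≢y x≢y wq xv vy
    ... | no q≢x = no-P4-path (≢-sym w≢x) (≢-sym q≢x) (≢-sym q≢v) xv vw wq
    leaves (inj₂ qw) with q ≟ y
    ... | yes refl = no-P4-path x≢y (≢-sym w≢x) (⟶⇒≢ vw) xv vy qw
    ... | no q≢y = no-P4-path q≢v q≢y w≢y qw wv vy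

  pendant-at-digon-path : ∀ {u x z q} → ¬ OnTriangle x → u ⟷ x → x ⟷ z → u ≢ z →
                          z ~ q → q ≡ x
  pendant-at-digon-path {u} {x} {z} {q} ¬tri (ux , xu) (xz , zx) u≢z z~q with q ≟ x
  ... | yes q≡x = q≡x
  ... | no q≢x = ⊥-elim (leaves z~q)
    where
    leaves : z ~ q → ⊥
    leaves (inj₁ zq) with q ≟ u
    ... | yes refl = ¬tri (z , q , xz , zq , ux)
    ... | no q≢u = no-P4-path u≢z (≢-sym q≢u) (≢-sym q≢x) ux xz zq
    leaves (inj₂ qz) with q ≟ u
    ... | yes refl = ¬tri (q , z , xu , qz , zx)
    ... | no q≢u = no-P4-path q≢x q≢u (≢-sym u≢z) qz zx xu

  no-peakless-2-path-off-triangles : ∀ {x v y} → ¬ OnTriangle v → x ⟶ v → v ⟶ y → x ≢ y →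
                                     ¬ Peak x → ¬ Peak v → ¬ Peak y → ⊥
  no-peakless-2-path-off-triangles {x} {v} {y} ¬tri xv vy x≢y ¬px ¬pv ¬py
    with digon-beater ¬tri ((x , xv) , (y , vy)) ¬pv
  ... | w , vw , w≻v with w ≟ x | w ≟ y
  ... | yes refl | _ =
    let z , xz , z≻x = digon-beater (off-triangle-spreads ¬tri (inj₂ xv)) (digon-middle (⟷-sym vw)) ¬px
    in ≻-asym (subst (_≻ x) (2-path-start-in-neighbour ¬tri xv vy x≢y (proj₂ xz)) z≻x) w≻v
  ... | no _ | yes refl =
    let z , yz , z≻y = digon-beater (off-triangle-spreads ¬tri (inj₁ vy)) (digon-middle (⟷-sym vw)) ¬py
    in ≻-asym (subst (_≻ y) (2-path-end-out-neighbour ¬tri xv vy x≢y (proj₁ yz)) z≻y) w≻v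
  ... | no w≢x | no w≢y =
    leaf-⊁-branching (pendant-at-2-path xv vy x≢y vw w≢x w≢y) (x , y , x≢y , inj₂ xv , inj₁ vy) w≻v

  no-peakless-digon-off-triangles : ∀ {x v} → ¬ OnTriangle v → x ⟷ v → ¬ Peak x → ¬ Peak v → ⊥
  no-peakless-digon-off-triangles {x} {v} ¬tri xv ¬px ¬pv
    with digon-beater ¬tri (digon-middle (⟷-sym xv)) ¬pv
  ... | w , vw , w≻v with w ≟ x
  ... | no w≢x =
    leaf-⊁-branching (pendant-at-digon-path ¬tri xv vw (≢-sym w≢x))
                     (x , w , ≢-sym w≢x , inj₂ (proj₁ xv) , inj₁ (proj₁ vw)) w≻v
  ... | yes refl with digon-beater (off-triangle-spreads ¬tri (inj₂ (proj₁ xv))) (digon-middle xv) ¬px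
  ...   | z , xz , z≻x with z ≟ v
  ...     | yes refl = ≻-asym z≻x w≻v
  ...     | no z≢v =
    let ¬tri-x = off-triangle-spreads ¬tri (inj₂ (proj₁ xv)) in
    leaf-⊁-branching (pendant-at-digon-path ¬tri-x (⟷-sym xv) xz (≢-sym z≢v))
                     (v , z , ≢-sym z≢v , inj₁ (proj₁ xv) , inj₁ (proj₁ xz)) z≻x

  no-peakless-2-walk : ∀ {x v y} → x ⟶ v → v ⟶ y → ¬ Peak x → ¬ Peak v → ¬ Peak y → ⊥
  no-peakless-2-walk {x} {v} {y} xv vy ¬px ¬pv ¬py with OnTriangle? v | x ≟ y
  ... | yes (_ , _ , vp , pq , qv) | _ = no-peakless-2-walk-on-triangle vp pq qv xv vy ¬px ¬pv ¬py
  ... | no ¬tri | yes refl = no-peakless-digon-off-triangles ¬tri (xv , vy) ¬px ¬pv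
  ... | no ¬tri | no x≢y = no-peakless-2-path-off-triangles ¬tri xv vy x≢y ¬px ¬pv ¬py

lemma44 : (G : Digraph) → Loopless G → ¬ ContainsSubgraph G K3 → ¬ ContainsSubgraph G P4 → Hom G C3++
lemma44 G loopless K3-free P4-free =
  independent-2-walk-transversal⇒Hom-C3++ G Peak Peak? peaks-independent no-peakless-2-walk
  where open Peaks G loopless K3-free P4-free
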